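{- Every monotone caterpillar graph is good.
   Context: An ordered graph on $N$ vertices is a graph with vertex set $[N]=\{1,\dots,N\}$ ordered by the usual order of integers. An ordered graph $G^<$ on $[n]$ is an ordered subgraph of an ordered graph $H^<$ on $[N]$ if there is a map $\phi:[n]\to[N]$ with $\phi(i)<\phi(j)$ whenever $i<j$ such that $\{\phi(i),\phi(j)\}$ is an edge of $H^<$ whenever $\{i,j\}$ is an edge of $G^<$. $K^<_N$ is the complete ordered graph on $[N]$. The ordered Ramsey number $r_<(G^<,H^<)$ is the least $N$ such that every red-blue coloring of the edges of $K^<_N$ contains a red copy of $G^<$ or a blue copy of $H^<$ as an ordered subgraph. A connected ordered graph $G^<$ on $m$ vertices is $n$-good if $r_<(G^<,K^<_n)=(m-1)(n-1)+1$, and good if it is $n$-good for every $n\in\mathbb{N}$. The ordered star $S^<_{l,r}$ is the ordered graph on $l+r-1$ vertices in which the $l$-th vertex is adjacent to all other vertices and there are no other edges; it is one-sided if $l=1$ or $r=1$. The join $G^<+H^<$ of ordered graphs $G^<$ (on $m$ vertices) and $H^<$ (on $n$ vertices) is the ordered graph on $m+n-1$ vertices obtained by identifying the leftmost vertex of $H^<$ with the rightmost vertex of $G^<$, with $G^<$ on the left. An ordered graph is a monotone caterpillar graph if it equals $S^<_{l_1,r_1}+\dots+S^<_{l_k,r_k}$ for some positive integers $k,l_1,\dots,l_k,r_1,\dots,r_k$ with $l_i=1$ or $r_i=1$ for each $i$. -}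

module Defs where

open import Data.Nat using (ℕ; zero; suc; _+_; _*_; _∸_; _≤_; _<_; _≡ᵇ_; _<ᵇ_)
open import Data.Bool using (Bool; true; false; _∧_; _∨_; not)
open import Data.Product using (Σ; _×_; _,_)
open import Data.Sum using (_⊎_)
open import Data.List using (List; []; _∷_)
open import Data.List.NonEmpty using (List⁺; _∷_)
open import Data.List.Relation.Unary.All using (All)
open import Relation.Nullary using (¬_)
open import Relation.Binary.PropositionalEquality using (_≡_)

-- An ordered graph on the vertex set {0,…,size-1} (0-based version of [size]),
-- ordered by the order of ℕ.  The pair {i,j} with i < j < size is an edge
-- iff  adj i j ≡ true.  Values of adj outside that range (or with i ≥ j) are
-- irrelevant: only pairs i < j < size are ever consulted.
record OrdGraph : Set where
  constructor mkOrdGraph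
  field
    size : ℕ
    adj  : ℕ → ℕ → Bool
open OrdGraph public

-- Red/blue colouring of the edges of K_N: edge {i,j}, i < j < N, is red iff
-- c i j ≡ true and blue iff c i j ≡ false.
Colouring : Set
Colouring = ℕ → ℕ → Bool

MonoCopy : (N : ℕ) → Colouring → Bool → OrdGraph → Set
MonoCopy N c b G =
  Σ (ℕ → ℕ) λ φ →
    (∀ i → i < size G → φ i < N) ×
    (∀ i j → i < j → j < size G → φ i < φ j) ×
    (∀ i j → i < j → j < size G → adj G i j ≡ true → c (φ i) (φ j) ≡ b)

Arrows : ℕ → OrdGraph → OrdGraph → Set
Arrows N G H = (c : Colouring) → MonoCopy N c true G ⊎ MonoCopy N c false H

OrdRamseyIs : OrdGraph → OrdGraph → ℕ → Set
OrdRamseyIs G H k = Arrows k G H × (∀ N → N < k → ¬ Arrows N G H)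

K : ℕ → OrdGraph
K n = mkOrdGraph n (λ _ _ → true)

NGood : ℕ → OrdGraph → Set
NGood n G = OrdRamseyIs G (K n) ((size G ∸ 1) * (n ∸ 1) + 1)

Good : OrdGraph → Set
Good G = ∀ n → 1 ≤ n → NGood n G

-- Ordered star S_{l,r} on l+r-1 vertices; the l-th vertex (0-based index l-1)
-- is adjacent to every other vertex, and there are no other edges.
Star : ℕ → ℕ → OrdGraph
Star l r = mkOrdGraph (l + r ∸ 1)
  (λ i j → not (i ≡ᵇ j) ∧ ((i ≡ᵇ (l ∸ 1)) ∨ (j ≡ᵇ (l ∸ 1))))

-- Join G + H on m+n-1 vertices: vertices 0..m-1 carry G, vertices
-- m-1..m+n-2 carry H (shifted by m-1), the last vertex of G identified with
-- the first vertex of H.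
Join : OrdGraph → OrdGraph → OrdGraph
Join G H = mkOrdGraph (size G + size H ∸ 1)
  (λ i j → ((i <ᵇ size G) ∧ (j <ᵇ size G) ∧ adj G i j)
         ∨ (((size G ∸ 1) ≤ᵇ' i) ∧ ((size G ∸ 1) ≤ᵇ' j)
             ∧ adj H (i ∸ (size G ∸ 1)) (j ∸ (size G ∸ 1))))
  where
  _≤ᵇ'_ : ℕ → ℕ → Bool
  a ≤ᵇ' b = a <ᵇ suc b

-- S_{l₁,r₁} + … + S_{l_k,r_k} for a nonempty list of parameter pairs
-- (the join is associative; we bracket to the right).
Caterpillar : List⁺ (ℕ × ℕ) → OrdGraph
Caterpillar ((l , r) ∷ ps) = joinFrom (Star l r) ps
  where
  joinFrom : OrdGraph → List (ℕ × ℕ) → OrdGraph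
  joinFrom G []              = G
  joinFrom G ((l' , r') ∷ qs) = Join G (joinFrom (Star l' r') qs)

OneSidedParams : ℕ × ℕ → Set
OneSidedParams (l , r) = 1 ≤ l × 1 ≤ r × (l ≡ 1 ⊎ r ≡ 1)

-- Call G colourable if, for every colouring of a finite vertex set X without a red copy
-- of G, the red graph on X is properly colourable with |G| - 1 colours. Then a colouring
-- of (|G| - 1)(n - 1) + 1 vertices without red G has, by pigeonhole, a colour class of n
-- vertices, which is a blue K_n. Conversely, if every cut between an initial segment of G
-- and the rest is crossed by an edge, colouring red exactly the pairs inside blocks of
-- |G| - 1 consecutive vertices has neither a red G nor a blue K_n on (|G| - 1)(n - 1)
-- vertices.
--
-- One-sided stars are colourable: without a red S_{a+1,1} every vertex has fewer than a
-- red left neighbours, so greedy colouring from the left uses a colours; S_{1,b+1} is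
-- symmetric. For S + H, let s be the set of vertices at which a red H starts: X \ s has
-- no red H and is coloured by induction, while s is coloured greedily as above, because a
-- red star inside s ends at a vertex of s, where a red H glues on to a red S + H. The set
-- s is only available classically, hence colourability is stated under double negation;
-- the copies themselves are then found by a finite search.

module Submission where

open import Defs
open import Data.Bool using (Bool; true; false; _∧_; _∨_; not; if_then_else_)
open import Data.Bool.Properties using (∧-conicalˡ; ∧-conicalʳ; not-¬; ¬-not; not-injective; T-≡)
  renaming (_≟_ to _≟ᵇ_)
open import Data.Empty using (⊥-elim)
open import Data.List using ([]; _∷_)
open import Data.List.NonEmpty using (List⁺; _∷_; toList)
open import Data.List.Relation.Unary.All using (All; []; _∷_)
open import Data.Nat
open import Data.Nat.DivMod
open import Data.Nat.Properties
open import Data.Product using (Σ; ∃; _×_; _,_; proj₁; proj₂; map₁)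
open import Data.Sum using (_⊎_; inj₁; inj₂)
open import Function using (_∘_; case_of_)
open import Function.Bundles using (module Equivalence)
open import Effect.Monad using (RawMonad)
open import Level using (0ℓ)
open import Relation.Nullary using (¬_; Dec; yes; no)
open import Relation.Nullary.Decidable using (¬¬-excluded-middle; map′; _×-dec_; _→-dec_)
open import Relation.Nullary.Negation using (¬¬-Monad)
open import Relation.Binary.PropositionalEquality

∧-intro : ∀ {a b} → a ≡ true → b ≡ true → a ∧ b ≡ true
∧-intro refl refl = refl

∨-elim : ∀ a {b} → a ∨ b ≡ true → a ≡ true ⊎ b ≡ true
∨-elim true  _ = inj₁ refl
∨-elim false p = inj₂ p

∨-introˡ : ∀ {a} b → a ≡ true → a ∨ b ≡ true
∨-introˡ b refl = refl

∨-introʳ : ∀ a {b} → b ≡ true → a ∨ b ≡ true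
∨-introʳ true  _ = refl
∨-introʳ false p = p

<⇒<ᵇ≡true : ∀ {m n} → m < n → (m <ᵇ n) ≡ true
<⇒<ᵇ≡true = Equivalence.to T-≡ ∘ <⇒<ᵇ

<ᵇ≡true⇒< : ∀ {m n} → (m <ᵇ n) ≡ true → m < n
<ᵇ≡true⇒< {m} {n} = <ᵇ⇒< m n ∘ Equivalence.from T-≡

≤⇒<ᵇ≡false : ∀ {m n} → n ≤ m → (m <ᵇ n) ≡ false
≤⇒<ᵇ≡false n≤m = ¬-not (λ m<n → <⇒≱ (<ᵇ≡true⇒< m<n) n≤m)

≡⇒≡ᵇ≡true : ∀ {m n} → m ≡ n → (m ≡ᵇ n) ≡ true
≡⇒≡ᵇ≡true {m} {n} = Equivalence.to T-≡ ∘ ≡⇒≡ᵇ m n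

≡ᵇ≡true⇒≡ : ∀ {m n} → (m ≡ᵇ n) ≡ true → m ≡ n
≡ᵇ≡true⇒≡ {m} {n} = ≡ᵇ⇒≡ m n ∘ Equivalence.from T-≡

≢⇒≡ᵇ≡false : ∀ {m n} → m ≢ n → (m ≡ᵇ n) ≡ false
≢⇒≡ᵇ≡false m≢n = ¬-not (m≢n ∘ ≡ᵇ≡true⇒≡)

⟨_⟩ : (ℕ → Bool) → ℕ → Set
⟨ X ⟩ v = X v ≡ true

infix  9 _⁻¹[_]
infixl 8 _∩_ _∖_

_∩_ _∖_ : (ℕ → Bool) → (ℕ → Bool) → ℕ → Bool
(X ∩ Y) v = X v ∧ Y v
(X ∖ Y) v = X v ∧ not (Y v)

_⁻¹[_] : (ℕ → ℕ) → ℕ → ℕ → Bool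
(κ ⁻¹[ j ]) v = κ v ≡ᵇ j

∩-⊆ˡ : ∀ X Y v → (X ∩ Y) v ≡ true → X v ≡ true
∩-⊆ˡ X Y v = ∧-conicalˡ (X v) (Y v)

∩-⊆ʳ : ∀ X Y v → (X ∩ Y) v ≡ true → Y v ≡ true
∩-⊆ʳ X Y v = ∧-conicalʳ (X v) (Y v)

∖-⊆ˡ : ∀ X Y v → (X ∖ Y) v ≡ true → X v ≡ true
∖-⊆ˡ X Y v = ∧-conicalˡ (X v) (not (Y v))

∖-excludes : ∀ X Y v → (X ∖ Y) v ≡ true → Y v ≡ false
∖-excludes X Y v = not-injective ∘ ∧-conicalʳ (X v) (not (Y v))

_[_↦_] : {A : Set} → (ℕ → A) → ℕ → A → ℕ → A
(f [ k ↦ w ]) i = if i ≡ᵇ k then w else f i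

[↦]-same : ∀ {A : Set} (f : ℕ → A) k w → (f [ k ↦ w ]) k ≡ w
[↦]-same f k w rewrite ≡⇒≡ᵇ≡true (refl {x = k}) = refl

[↦]-other : ∀ {A : Set} (f : ℕ → A) {k} w {i} → i ≢ k → (f [ k ↦ w ]) i ≡ f i
[↦]-other f w i≢k rewrite ≢⇒≡ᵇ≡false i≢k = refl

-- Counting and pigeonhole

count : (ℕ → Bool) → ℕ → ℕ
count p zero    = zero
count p (suc k) = if p k then suc (count p k) else count p k

count-partition : ∀ p q k → count p k ≡ count (p ∩ q) k + count (p ∖ q) k
count-partition p q zero    = refl
count-partition p q (suc k) with p k | q k
... | true  | true  = cong suc (count-partition p q k)
... | true  | false = trans (cong suc (count-partition p q k)) (sym (+-suc _ _))
... | false | _     = count-partition p q k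

count-mono : ∀ (p q : ℕ → Bool) k → (∀ u → u < k → p u ≡ true → q u ≡ true) → count p k ≤ count q k
count-mono p q zero    p⇒q = z≤n
count-mono p q (suc k) p⇒q with p k in pk | q k in qk | count-mono p q k (λ u → p⇒q u ∘ m<n⇒m<1+n)
... | true  | true  | ih = s≤s ih
... | true  | false | ih = ⊥-elim (not-¬ (p⇒q k ≤-refl pk) qk)
... | false | true  | ih = m≤n⇒m≤1+n ih
... | false | false | ih = ih

count-all : ∀ p k → (∀ u → u < k → p u ≡ true) → count p k ≡ k
count-all p zero    all = refl
count-all p (suc k) all rewrite all k ≤-refl = cong suc (count-all p k (λ u → all u ∘ m<n⇒m<1+n))

count-none : ∀ p k → (∀ u → u < k → p u ≡ false) → count p k ≡ 0
count-none p zero    none = refl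
count-none p (suc k) none rewrite none k ≤-refl = count-none p k (λ u → none u ∘ m<n⇒m<1+n)

count≡0⇒none : ∀ p k → count p k ≡ 0 → ∀ u → u < k → p u ≡ false
count≡0⇒none p (suc k) c≡0 u u<k with p k in pk | m<1+n⇒m<n∨m≡n u<k
... | false | inj₁ u<k′ = count≡0⇒none p k c≡0 u u<k′
... | false | inj₂ refl = pk

Increasing : (ℕ → ℕ) → ℕ → Set
Increasing φ t = ∀ i j → i < j → j < t → φ i < φ j

Increasing⇒≤ : ∀ {φ t} → Increasing φ t → ∀ {i j} → i ≤ j → j < t → φ i ≤ φ j
Increasing⇒≤ inc {i} {j} i≤j j<t with m≤n⇒m<n∨m≡n i≤j
... | inj₁ i<j  = <⇒≤ (inc i j i<j j<t)
... | inj₂ refl = ≤-refl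

Increasing⇒+ : ∀ {φ t} → Increasing φ t → ∀ j → j < t → φ 0 + j ≤ φ j
Increasing⇒+ {φ} inc zero    _     = ≤-reflexive (+-identityʳ (φ 0))
Increasing⇒+ {φ} inc (suc j) 1+j<t = begin
  φ 0 + suc j    ≡⟨ +-suc (φ 0) j ⟩
  suc (φ 0 + j)  ≤⟨ s≤s (Increasing⇒+ inc j (<-trans (n<1+n j) 1+j<t)) ⟩
  suc (φ j)      ≤⟨ inc j (suc j) (n<1+n j) 1+j<t ⟩
  φ (suc j)      ∎
  where open ≤-Reasoning

enumerate : ∀ p k t → t ≤ count p k →
  Σ (ℕ → ℕ) λ φ → (∀ i → i < t → φ i < k × p (φ i) ≡ true) × Increasing φ t
enumerate p k       zero    _ = (λ _ → 0) , (λ _ ()) , (λ _ _ _ ())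
enumerate p (suc k) (suc t) t≤c with p k in pk
... | false = let φ , φ-in , φ-inc = enumerate p k (suc t) t≤c
              in φ , (λ i i<t → map₁ m<n⇒m<1+n (φ-in i i<t)) , φ-inc
... | true  = φ [ t ↦ k ] , inside , increasing
  where
  enum = enumerate p k t (≤-pred t≤c)
  φ = proj₁ enum
  φ-in = proj₁ (proj₂ enum)
  inside : ∀ i → i < suc t → (φ [ t ↦ k ]) i < suc k × p ((φ [ t ↦ k ]) i) ≡ true
  inside i i<1+t with m<1+n⇒m<n∨m≡n i<1+t
  ... | inj₂ refl rewrite [↦]-same φ i k = ≤-refl , pk
  ... | inj₁ i<t  rewrite [↦]-other φ k (<⇒≢ i<t) = map₁ m<n⇒m<1+n (φ-in i i<t)
  increasing : Increasing (φ [ t ↦ k ]) (suc t)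
  increasing i j i<j j<1+t with m<1+n⇒m<n∨m≡n j<1+t
  ... | inj₂ refl rewrite [↦]-same φ j k | [↦]-other φ k (<⇒≢ i<j) = proj₁ (φ-in i i<j)
  ... | inj₁ j<t  rewrite [↦]-other φ k (<⇒≢ (<-trans i<j j<t)) | [↦]-other φ k (<⇒≢ j<t) =
    proj₂ (proj₂ enum) i j i<j j<t

pigeonhole : ∀ D p (κ : ℕ → ℕ) t N → (∀ v → v < N → p v ≡ true → κ v < D) →
  D * t < count p N → ∃ λ j → j < D × t < count (p ∩ κ ⁻¹[ j ]) N
pigeonhole zero p κ t N κ<0 0<c
  rewrite count-none p N (λ v v<N → ¬-not (λ pv → n≮0 (κ<0 v v<N pv))) = ⊥-elim (n≮0 0<c)
pigeonhole (suc D) p κ t N κ<1+D t+Dt<c with t <? count (p ∩ κ ⁻¹[ D ]) N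
... | yes t<cD = D , ≤-refl , t<cD
... | no  t≮cD with pigeonhole D (p ∖ κ ⁻¹[ D ]) κ t N κ<D (+-cancelˡ-< t _ _ t+Dt<t+crest)
  where
  κ<D : ∀ v → v < N → (p ∖ κ ⁻¹[ D ]) v ≡ true → κ v < D
  κ<D v v<N rv = ≤∧≢⇒< (≤-pred (κ<1+D v v<N (∖-⊆ˡ p (κ ⁻¹[ D ]) v rv)))
                       (λ κv≡D → not-¬ (≡⇒≡ᵇ≡true κv≡D) (∖-excludes p (κ ⁻¹[ D ]) v rv))
  t+Dt<t+crest : t + D * t < t + count (p ∖ κ ⁻¹[ D ]) N
  t+Dt<t+crest = <-≤-trans t+Dt<c (begin
    count p N                                            ≡⟨ count-partition p (κ ⁻¹[ D ]) N ⟩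
    count (p ∩ κ ⁻¹[ D ]) N + count (p ∖ κ ⁻¹[ D ]) N    ≤⟨ +-monoˡ-≤ _ (≮⇒≥ t≮cD) ⟩
    t + count (p ∖ κ ⁻¹[ D ]) N                          ∎)
    where open ≤-Reasoning
... | j , j<D , t<cj = j , m<n⇒m<1+n j<D , <-≤-trans t<cj (count-mono _ _ N narrow)
  where
  narrow : ∀ v → v < N → (p ∖ κ ⁻¹[ D ] ∩ κ ⁻¹[ j ]) v ≡ true → (p ∩ κ ⁻¹[ j ]) v ≡ true
  narrow v _ q = ∧-intro (∖-⊆ˡ p (κ ⁻¹[ D ]) v (∩-⊆ˡ (p ∖ κ ⁻¹[ D ]) (κ ⁻¹[ j ]) v q))
                         (∩-⊆ʳ (p ∖ κ ⁻¹[ D ]) (κ ⁻¹[ j ]) v q)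

unused-colour : ∀ D p k (κ : ℕ → ℕ) → count p k < D →
  ∃ λ x → x < D × (∀ u → u < k → p u ≡ true → κ u ≢ x)
unused-colour (suc D) p k κ c<1+D with count (p ∩ κ ⁻¹[ D ]) k in cD≡
... | zero = D , ≤-refl , λ u u<k pu κu≡D →
  not-¬ (∧-intro pu (≡⇒≡ᵇ≡true κu≡D)) (count≡0⇒none _ k cD≡ u u<k)
... | suc cD-1 with unused-colour D (p ∖ κ ⁻¹[ D ]) k κ crest<D
  where
  crest<D : count (p ∖ κ ⁻¹[ D ]) k < D
  crest<D = ≤-pred (≤-trans (s≤s (s≤s (m≤n+m _ cD-1))) (begin-strict
    suc cD-1 + count (p ∖ κ ⁻¹[ D ]) k                 ≡⟨ cong (_+ count (p ∖ κ ⁻¹[ D ]) k) cD≡ ⟨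
    count (p ∩ κ ⁻¹[ D ]) k + count (p ∖ κ ⁻¹[ D ]) k  ≡⟨ count-partition p (κ ⁻¹[ D ]) k ⟨
    count p k                                          <⟨ c<1+D ⟩
    suc D                                              ∎))
    where open ≤-Reasoning
... | x , x<D , unused = x , m<n⇒m<1+n x<D , avoids
  where
  avoids : ∀ u → u < k → p u ≡ true → κ u ≢ x
  avoids u u<k pu κu≡x with κ u ≟ D
  ... | yes κu≡D = <-irrefl (trans (sym κu≡x) κu≡D) x<D
  ... | no  κu≢D = unused u u<k (∧-intro pu (cong not (≢⇒≡ᵇ≡false κu≢D))) κu≡x

-- Proper colourings of the red graph

record ProperColouring (c : Colouring) (A : ℕ → Set) (D : ℕ) : Set where
  constructor colouring
  field
    colour   : ℕ → ℕ
    colour<D : ∀ v → A v → colour v < D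
    proper   : ∀ u v → u < v → A u → A v → c u v ≡ true → colour u ≢ colour v
open ProperColouring

restrict : ∀ {c A B D} → (∀ v → B v → A v) → ProperColouring c A D → ProperColouring c B D
restrict B⊆A κ = colouring (colour κ) (λ v → colour<D κ v ∘ B⊆A v)
  (λ u v u<v Bu Bv → proper κ u v u<v (B⊆A u Bu) (B⊆A v Bv))

extend-colouring : ∀ {c A B D} (κ : ProperColouring c A D) k x → x < D →
  (∀ v → B v → v ≢ k → A v) →
  (∀ u → u < k → B u → c u k ≡ true → colour κ u ≢ x) →
  (∀ u → k < u → B u → c k u ≡ true → colour κ u ≢ x) →
  ProperColouring c B D
extend-colouring {c = c} {B = B} {D = D} κ k x x<D B⊆A+k left right = colouring κ′ κ′<D κ′-proper
  where
  κ′ = colour κ [ k ↦ x ]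
  κ′<D : ∀ v → B v → κ′ v < D
  κ′<D v Bv with v ≟ k
  ... | yes refl rewrite [↦]-same (colour κ) v x = x<D
  ... | no  v≢k  rewrite [↦]-other (colour κ) x v≢k = colour<D κ v (B⊆A+k v Bv v≢k)
  κ′-proper : ∀ u v → u < v → B u → B v → c u v ≡ true → κ′ u ≢ κ′ v
  κ′-proper u v u<v Bu Bv cuv with u ≟ k | v ≟ k
  ... | yes refl | _ rewrite [↦]-same (colour κ) u x | [↦]-other (colour κ) x (≢-sym (<⇒≢ u<v)) =
    ≢-sym (right v u<v Bv cuv)
  ... | no u≢k | yes refl rewrite [↦]-same (colour κ) v x | [↦]-other (colour κ) x u≢k =
    left u u<v Bu cuv
  ... | no u≢k | no v≢k rewrite [↦]-other (colour κ) x u≢k | [↦]-other (colour κ) x v≢k =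
    proper κ u v u<v (B⊆A+k u Bu u≢k) (B⊆A+k v Bv v≢k) cuv

combine-colourings : ∀ {c X D E} (s : ℕ → Bool) →
  ProperColouring c ⟨ X ∩ s ⟩ D → ProperColouring c ⟨ X ∖ s ⟩ E → ProperColouring c ⟨ X ⟩ (D + E)
combine-colourings {c} {X} {D} {E} s κ₁ κ₂ = colouring κ κ<D+E κ-proper
  where
  κ : ℕ → ℕ
  κ v = if s v then colour κ₁ v else D + colour κ₂ v
  κ<D+E : ∀ v → X v ≡ true → κ v < D + E
  κ<D+E v Xv with s v in sv
  ... | true  = ≤-trans (colour<D κ₁ v (∧-intro Xv sv)) (m≤m+n D E)
  ... | false = +-monoʳ-< D (colour<D κ₂ v (∧-intro Xv (cong not sv)))
  κ-proper : ∀ u v → u < v → X u ≡ true → X v ≡ true → c u v ≡ true → κ u ≢ κ v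
  κ-proper u v u<v Xu Xv cuv with s u in su | s v in sv
  ... | true  | true  = proper κ₁ u v u<v (∧-intro Xu su) (∧-intro Xv sv) cuv
  ... | false | false = proper κ₂ u v u<v (∧-intro Xu (cong not su)) (∧-intro Xv (cong not sv)) cuv
                        ∘ +-cancelˡ-≡ D _ _
  ... | true  | false = λ e →
    <⇒≱ (colour<D κ₁ u (∧-intro Xu su)) (≤-trans (m≤m+n D _) (≤-reflexive (sym e)))
  ... | false | true  = λ e →
    <⇒≱ (colour<D κ₁ v (∧-intro Xv sv)) (≤-trans (m≤m+n D _) (≤-reflexive e))

Bounded : (ℕ → Bool) → ℕ → Set
Bounded X N = ∀ v → X v ≡ true → v < N

empty-colouring : ∀ {c A} D → (∀ v → ¬ A v) → ProperColouring c A D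
empty-colouring D empty = colouring (λ _ → 0) (λ v → ⊥-elim ∘ empty v) (λ u v _ Au → ⊥-elim (empty u Au))

greedy-left : ∀ c X N D → Bounded X N →
  (∀ v → X v ≡ true → count (λ u → X u ∧ c u v) v < D) →
  ProperColouring c ⟨ X ⟩ D
greedy-left c X N D bounded few = restrict (λ v Xv → bounded v Xv , Xv) (prefix N)
  where
  Prefix : ℕ → ℕ → Set
  Prefix k v = v < k × X v ≡ true
  prefix : ∀ k → ProperColouring c (Prefix k) D
  prefix zero = empty-colouring D (λ v → n≮0 ∘ proj₁)
  prefix (suc k) with X k in Xk
  ... | false = restrict shrink (prefix k)
    where
    shrink : ∀ v → Prefix (suc k) v → Prefix k v
    shrink v (v<1+k , Xv) with m<1+n⇒m<n∨m≡n v<1+k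
    ... | inj₁ v<k  = v<k , Xv
    ... | inj₂ refl = ⊥-elim (not-¬ Xv Xk)
  ... | true =
    let x , x<D , unused = unused-colour D (λ u → X u ∧ c u k) k (colour (prefix k)) (few k Xk)
    in extend-colouring (prefix k) k x x<D
         (λ v (v<1+k , Xv) v≢k → ≤∧≢⇒< (≤-pred v<1+k) v≢k , Xv)
         (λ u u<k (_ , Xu) cuk → unused u u<k (∧-intro Xu cuk))
         (λ u k<u (u<1+k , _) _ → ⊥-elim (<⇒≱ k<u (≤-pred u<1+k)))

greedy-right : ∀ c X N D → Bounded X N →
  (∀ v → X v ≡ true → count (λ w → (v <ᵇ w) ∧ (X w ∧ c v w)) N < D) →
  ProperColouring c ⟨ X ⟩ D
greedy-right c X N D bounded few = restrict (λ v Xv → z≤n , Xv) (suffix N 0 refl)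
  where
  Suffix : ℕ → ℕ → Set
  Suffix k v = k ≤ v × X v ≡ true
  suffix : ∀ t k → k + t ≡ N → ProperColouring c (Suffix k) D
  suffix zero k k+0≡N = empty-colouring D
    (λ v (k≤v , Xv) → <⇒≱ (bounded v Xv) (subst (_≤ v) (trans (sym (+-identityʳ k)) k+0≡N) k≤v))
  suffix (suc t) k k+1+t≡N with X k in Xk
  ... | false = restrict shrink κ
    where
    κ = suffix t (suc k) (trans (sym (+-suc k t)) k+1+t≡N)
    shrink : ∀ v → Suffix k v → Suffix (suc k) v
    shrink v (k≤v , Xv) = ≤∧≢⇒< k≤v (λ { refl → not-¬ Xv Xk }) , Xv
  ... | true =
    let κ = suffix t (suc k) (trans (sym (+-suc k t)) k+1+t≡N)
        x , x<D , unused = unused-colour D (λ w → (k <ᵇ w) ∧ (X w ∧ c k w)) N (colour κ) (few k Xk)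
    in extend-colouring κ k x x<D
         (λ v (k≤v , Xv) v≢k → ≤∧≢⇒< k≤v (≢-sym v≢k) , Xv)
         (λ u u<k (k≤u , _) _ → ⊥-elim (<⇒≱ u<k k≤u))
         (λ u k<u (_ , Xu) cku → unused u (bounded u Xu) (∧-intro (<⇒<ᵇ≡true k<u) (∧-intro Xu cku)))

-- Red copies of joins and stars

record RedCopy (c : Colouring) (X : ℕ → Bool) (G : OrdGraph) : Set where
  constructor redCopy
  field
    embed      : ℕ → ℕ
    embed-in   : ∀ i → i < size G → X (embed i) ≡ true
    increasing : Increasing embed (size G)
    red        : ∀ i j → i < j → j < size G → adj G i j ≡ true → c (embed i) (embed j) ≡ true
open RedCopy

copy-⊆ : ∀ {c X Y G} → (∀ v → X v ≡ true → Y v ≡ true) → RedCopy c X G → RedCopy c Y G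
copy-⊆ X⊆Y α = redCopy (embed α) (λ i → X⊆Y _ ∘ embed-in α i) (increasing α) (red α)

module _ (G H : OrdGraph) {g} (|G|≡1+g : size G ≡ suc g) where

  size-Join : size (Join G H) ≡ g + size H
  size-Join rewrite |G|≡1+g = refl

  index-in-H : ∀ {i} → g ≤ i → i < size (Join G H) → i ∸ g < size H
  index-in-H {i} g≤i i<|J| =
    subst (i ∸ g <_) (m+n∸m≡n g (size H)) (∸-monoˡ-< (subst (i <_) size-Join i<|J|) g≤i)

  adj-Join-elim : ∀ i j → adj (Join G H) i j ≡ true →
    (j < size G × adj G i j ≡ true) ⊎ (g ≤ i × adj H (i ∸ g) (j ∸ g) ≡ true)
  adj-Join-elim i j e rewrite |G|≡1+g with ∨-elim ((i <ᵇ suc g) ∧ (j <ᵇ suc g) ∧ adj G i j) e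
  ... | inj₁ eG = let eG′ = ∧-conicalʳ (i <ᵇ suc g) _ eG in
    inj₁ (<ᵇ≡true⇒< (∧-conicalˡ (j <ᵇ suc g) _ eG′) , ∧-conicalʳ (j <ᵇ suc g) _ eG′)
  ... | inj₂ eH = let eH′ = ∧-conicalʳ (g <ᵇ suc i) _ eH in
    inj₂ (≤-pred (<ᵇ≡true⇒< (∧-conicalˡ (g <ᵇ suc i) _ eH)) , ∧-conicalʳ (g <ᵇ suc j) _ eH′)

  adj-Join-introˡ : ∀ i j → i < j → j < size G → adj G i j ≡ true → adj (Join G H) i j ≡ true
  adj-Join-introˡ i j i<j j<|G| e = ∨-introˡ _
    (∧-intro (<⇒<ᵇ≡true (<-trans i<j j<|G|)) (∧-intro (<⇒<ᵇ≡true j<|G|) e))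

  adj-Join-introʳ : ∀ i j → g ≤ i → i < j → adj H (i ∸ g) (j ∸ g) ≡ true → adj (Join G H) i j ≡ true
  adj-Join-introʳ i j g≤i i<j e rewrite |G|≡1+g = ∨-introʳ _
    (∧-intro (<⇒<ᵇ≡true (s≤s g≤i)) (∧-intro (<⇒<ᵇ≡true (s≤s (≤-trans g≤i (<⇒≤ i<j)))) e))

  join-copy : ∀ {c X} (α : RedCopy c X G) (ψ : RedCopy c X H) → embed α g ≡ embed ψ 0 →
    RedCopy c X (Join G H)
  join-copy {c} {X} α ψ glued = redCopy φ φ-in φ-increasing φ-red
    where
    φ : ℕ → ℕ
    φ i = if i <ᵇ g then embed α i else embed ψ (i ∸ g)
    φ-left : ∀ {i} → i ≤ g → φ i ≡ embed α i
    φ-left {i} i≤g with m≤n⇒m<n∨m≡n i≤g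
    ... | inj₁ i<g  rewrite <⇒<ᵇ≡true i<g = refl
    ... | inj₂ refl rewrite ≤⇒<ᵇ≡false (≤-refl {i}) | n∸n≡0 i = sym glued
    φ-right : ∀ {i} → g ≤ i → φ i ≡ embed ψ (i ∸ g)
    φ-right g≤i rewrite ≤⇒<ᵇ≡false g≤i = refl
    in-G : ∀ {i} → i ≤ g → i < size G
    in-G i≤g = subst (_ <_) (sym |G|≡1+g) (s≤s i≤g)
    φ-in : ∀ i → i < size (Join G H) → X (φ i) ≡ true
    φ-in i i<|J| with i ≤? g
    ... | yes i≤g rewrite φ-left i≤g = embed-in α i (in-G i≤g)
    ... | no  i≰g rewrite φ-right (<⇒≤ (≰⇒> i≰g)) = embed-in ψ (i ∸ g) (index-in-H (<⇒≤ (≰⇒> i≰g)) i<|J|)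
    φ-increasing : Increasing φ (size (Join G H))
    φ-increasing i j i<j j<|J| with j ≤? g | i <? g
    ... | yes j≤g | _ rewrite φ-left (<⇒≤ (<-≤-trans i<j j≤g)) | φ-left j≤g =
      increasing α i j i<j (in-G j≤g)
    ... | no j≰g | yes i<g rewrite φ-left (<⇒≤ i<g) | φ-right (<⇒≤ (≰⇒> j≰g)) = begin-strict
      embed α i         <⟨ increasing α i g i<g (in-G ≤-refl) ⟩
      embed α g         ≡⟨ glued ⟩
      embed ψ 0         <⟨ increasing ψ 0 (j ∸ g) (m<n⇒0<n∸m (≰⇒> j≰g))
                                      (index-in-H (<⇒≤ (≰⇒> j≰g)) j<|J|) ⟩
      embed ψ (j ∸ g)   ∎
      where open ≤-Reasoning
    ... | no j≰g | no i≮g rewrite φ-right (≮⇒≥ i≮g) | φ-right (≤-trans (≮⇒≥ i≮g) (<⇒≤ i<j)) =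
      increasing ψ (i ∸ g) (j ∸ g) (∸-monoˡ-< i<j (≮⇒≥ i≮g))
                 (index-in-H (≤-trans (≮⇒≥ i≮g) (<⇒≤ i<j)) j<|J|)
    φ-red : ∀ i j → i < j → j < size (Join G H) → adj (Join G H) i j ≡ true → c (φ i) (φ j) ≡ true
    φ-red i j i<j j<|J| e with adj-Join-elim i j e
    ... | inj₁ (j<|G| , eG) rewrite φ-left (≤-pred (subst (i <_) |G|≡1+g (<-trans i<j j<|G|)))
                                  | φ-left (≤-pred (subst (j <_) |G|≡1+g j<|G|)) =
      red α i j i<j j<|G| eG
    ... | inj₂ (g≤i , eH) rewrite φ-right g≤i | φ-right (≤-trans g≤i (<⇒≤ i<j)) =
      red ψ (i ∸ g) (j ∸ g) (∸-monoˡ-< i<j g≤i) (index-in-H (≤-trans g≤i (<⇒≤ i<j)) j<|J|) eH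

size-Join-suc : ∀ G H {g h} → size G ≡ suc g → size H ≡ suc h → size (Join G H) ≡ suc (g + h)
size-Join-suc G H {g} {h} |G|≡1+g |H|≡1+h =
  trans (size-Join G H |G|≡1+g) (trans (cong (g +_) |H|≡1+h) (+-suc g h))

adj-Star-elim : ∀ l r i j → adj (Star l r) i j ≡ true → i ≡ l ∸ 1 ⊎ j ≡ l ∸ 1
adj-Star-elim l r i j e with ∨-elim (i ≡ᵇ (l ∸ 1)) (∧-conicalʳ (not (i ≡ᵇ j)) _ e)
... | inj₁ i≡c = inj₁ (≡ᵇ≡true⇒≡ i≡c)
... | inj₂ j≡c = inj₂ (≡ᵇ≡true⇒≡ j≡c)

size-left-star : ∀ a → size (Star (suc a) 1) ≡ suc a
size-left-star a = +-comm a 1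

few-red-left-neighbours : ∀ c X a v → X v ≡ true →
  (∀ (α : RedCopy c X (Star (suc a) 1)) → embed α a ≢ v) →
  count (λ u → X u ∧ c u v) v < a
few-red-left-neighbours c X a v Xv no-star with count (λ u → X u ∧ c u v) v <? a
... | yes few  = few
... | no  many = ⊥-elim (no-star (redCopy α α-in α-increasing α-red) ([↦]-same u a v))
  where
  leaves = enumerate (λ u → X u ∧ c u v) v a (≮⇒≥ many)
  u = proj₁ leaves
  leaf = proj₁ (proj₂ leaves)
  α = u [ a ↦ v ]
  |S| = size (Star (suc a) 1)
  leaf-index : ∀ {i} → i < |S| → i ≢ a → i < a
  leaf-index {i} i<|S| i≢a = ≤∧≢⇒< (≤-pred (subst (i <_) (size-left-star a) i<|S|)) i≢a
  α-in : ∀ i → i < |S| → X (α i) ≡ true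
  α-in i i<|S| with i ≟ a
  ... | yes refl rewrite [↦]-same u i v = Xv
  ... | no  i≢a  rewrite [↦]-other u v i≢a =
    ∧-conicalˡ (X (u i)) _ (proj₂ (leaf i (leaf-index i<|S| i≢a)))
  α-increasing : Increasing α |S|
  α-increasing i j i<j j<|S| with j ≟ a
  ... | yes refl rewrite [↦]-same u j v | [↦]-other u v (<⇒≢ i<j) = proj₁ (leaf i i<j)
  ... | no  j≢a  rewrite [↦]-other u v j≢a
                       | [↦]-other u v (<⇒≢ (<-trans i<j (leaf-index j<|S| j≢a))) =
    proj₂ (proj₂ leaves) i j i<j (leaf-index j<|S| j≢a)
  α-red : ∀ i j → i < j → j < |S| → adj (Star (suc a) 1) i j ≡ true → c (α i) (α j) ≡ true
  α-red i j i<j j<|S| e with adj-Star-elim (suc a) 1 i j e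
  ... | inj₁ refl = ⊥-elim (<⇒≱ i<j (≤-pred (subst (j <_) (size-left-star a) j<|S|)))
  ... | inj₂ refl rewrite [↦]-same u j v | [↦]-other u v (<⇒≢ i<j) =
    ∧-conicalʳ (X (u i)) _ (proj₂ (leaf i i<j))

few-red-right-neighbours : ∀ c X N b v → X v ≡ true →
  (∀ (α : RedCopy c X (Star 1 (suc b))) → embed α 0 ≢ v) →
  count (λ w → (v <ᵇ w) ∧ (X w ∧ c v w)) N < b
few-red-right-neighbours c X N b v Xv no-star with count (λ w → (v <ᵇ w) ∧ (X w ∧ c v w)) N <? b
... | yes few  = few
... | no  many = ⊥-elim (no-star (redCopy α α-in α-increasing α-red) refl)
  where
  leaves = enumerate (λ w → (v <ᵇ w) ∧ (X w ∧ c v w)) N b (≮⇒≥ many)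
  w = proj₁ leaves
  leaf : ∀ i → i < b → (v <ᵇ w i) ∧ (X (w i) ∧ c v (w i)) ≡ true
  leaf i i<b = proj₂ (proj₁ (proj₂ leaves) i i<b)
  α : ℕ → ℕ
  α zero    = v
  α (suc i) = w i
  α-in : ∀ i → i < suc b → X (α i) ≡ true
  α-in zero    _         = Xv
  α-in (suc i) (s≤s i<b) = ∧-conicalˡ (X (w i)) _ (∧-conicalʳ (v <ᵇ w i) _ (leaf i i<b))
  α-increasing : Increasing α (suc b)
  α-increasing zero    (suc j) _         (s≤s j<b) = <ᵇ≡true⇒< (∧-conicalˡ (v <ᵇ w j) _ (leaf j j<b))
  α-increasing (suc i) (suc j) (s≤s i<j) (s≤s j<b) = proj₂ (proj₂ leaves) i j i<j j<b
  α-red : ∀ i j → i < j → j < suc b → adj (Star 1 (suc b)) i j ≡ true → c (α i) (α j) ≡ true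
  α-red zero    (suc j) _ (s≤s j<b) _ = ∧-conicalʳ (X (w j)) _ (∧-conicalʳ (v <ᵇ w j) _ (leaf j j<b))
  α-red (suc i) (suc j) _ _ e with adj-Star-elim 1 (suc b) (suc i) (suc j) e
  ... | inj₁ ()
  ... | inj₂ ()

-- Colourability of caterpillars

Decides : ℕ → (ℕ → Set) → (ℕ → Bool) → Set
Decides N P s = ∀ v → v < N → (s v ≡ true → P v) × (P v → s v ≡ true)

Decides-extend : ∀ {P N} s b → Decides N P s → (b ≡ true → P N) → (P N → b ≡ true) →
  Decides (suc N) P (s [ N ↦ b ])
Decides-extend s b s-decides b⇒P P⇒b v v<1+N with m<1+n⇒m<n∨m≡n v<1+N
... | inj₁ v<N  rewrite [↦]-other s b (<⇒≢ v<N) = s-decides v v<N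
... | inj₂ refl rewrite [↦]-same s v b = b⇒P , P⇒b

module _ where
  open RawMonad (¬¬-Monad {a = 0ℓ})

  ¬¬-decider : ∀ (P : ℕ → Set) N → ¬ ¬ Σ (ℕ → Bool) (Decides N P)
  ¬¬-decider P zero    = pure ((λ _ → false) , λ _ ())
  ¬¬-decider P (suc N) = do
    s , s-decides ← ¬¬-decider P N
    P? ← ¬¬-excluded-middle
    pure (case P? of λ where
      (yes p) → s [ N ↦ true ]  , Decides-extend s true  s-decides (λ _ → p) (λ _ → refl)
      (no ¬p) → s [ N ↦ false ] , Decides-extend s false s-decides (λ ()) (⊥-elim ∘ ¬p))

RedFreeColourable : OrdGraph → Set
RedFreeColourable G = ∀ c X N → Bounded X N → ¬ RedCopy c X G →
  ¬ ¬ ProperColouring c ⟨ X ⟩ (size G ∸ 1)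

left-star-colourable : ∀ a → RedFreeColourable (Star (suc a) 1)
left-star-colourable a c X N bounded no-copy ¬κ =
  ¬κ (subst (ProperColouring c ⟨ X ⟩) (sym (cong (_∸ 1) (size-left-star a)))
       (greedy-left c X N a bounded (λ v Xv → few-red-left-neighbours c X a v Xv (λ α _ → no-copy α))))

right-star-colourable : ∀ b → RedFreeColourable (Star 1 (suc b))
right-star-colourable b c X N bounded no-copy ¬κ =
  ¬κ (greedy-right c X N b bounded (λ v Xv → few-red-right-neighbours c X N b v Xv (λ α _ → no-copy α)))

StartsRedCopy : Colouring → (ℕ → Bool) → OrdGraph → ℕ → Set
StartsRedCopy c X H v = Σ (RedCopy c X H) λ ψ → embed ψ 0 ≡ v

StartsColourable : OrdGraph → OrdGraph → ℕ → Set
StartsColourable G H g = ∀ c X N → Bounded X N → ¬ RedCopy c X (Join G H) →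
  ∀ s → Decides N (StartsRedCopy c X H) s → ProperColouring c ⟨ X ∩ s ⟩ g

join-colourable : ∀ G H {g h} → size G ≡ suc g → size H ≡ suc h →
  StartsColourable G H g → RedFreeColourable H → RedFreeColourable (Join G H)
join-colourable G H {g} {h} |G|≡1+g |H|≡1+h starts-colourable H-colourable c X N bounded no-copy = do
    s , s-decides ← ¬¬-decider (StartsRedCopy c X H) N
    κ ← H-colourable c (X ∖ s) N (λ v → bounded v ∘ ∖-⊆ˡ X s v) (no-H-copy s s-decides)
    pure (subst (ProperColouring c ⟨ X ⟩) (sym (cong (_∸ 1) (size-Join-suc G H |G|≡1+g |H|≡1+h)))
            (combine-colourings s (starts-colourable c X N bounded no-copy s s-decides)
                                  (subst (ProperColouring c ⟨ X ∖ s ⟩) (cong (_∸ 1) |H|≡1+h) κ)))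
  where
  open RawMonad (¬¬-Monad {a = 0ℓ})
  no-H-copy : ∀ s → Decides N (StartsRedCopy c X H) s → ¬ RedCopy c (X ∖ s) H
  no-H-copy s s-decides ψ =
    not-¬ (proj₂ (s-decides ψ₀ (bounded ψ₀ (∖-⊆ˡ X s ψ₀ ψ₀∈))) (copy-⊆ (∖-⊆ˡ X s) ψ , refl))
          (∖-excludes X s ψ₀ ψ₀∈)
    where
    ψ₀ = embed ψ 0
    ψ₀∈ = embed-in ψ 0 (subst (0 <_) (sym |H|≡1+h) (s≤s z≤n))

left-star-join-colourable : ∀ a H {h} → size H ≡ suc h → RedFreeColourable H →
  RedFreeColourable (Join (Star (suc a) 1) H)
left-star-join-colourable a H |H|≡1+h H-colourable =
  join-colourable (Star (suc a) 1) H (size-left-star a) |H|≡1+h starts-colourable H-colourable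
  where
  starts-colourable : StartsColourable (Star (suc a) 1) H a
  starts-colourable c X N bounded no-copy s s-decides =
    greedy-left c (X ∩ s) N a (λ v → bounded v ∘ ∩-⊆ˡ X s v) λ v v∈ →
      few-red-left-neighbours c (X ∩ s) a v v∈ λ α centre≡v →
        let ψ , ψ₀≡v = proj₁ (s-decides v (bounded v (∩-⊆ˡ X s v v∈))) (∩-⊆ʳ X s v v∈)
        in no-copy (join-copy (Star (suc a) 1) H (size-left-star a)
                      (copy-⊆ (∩-⊆ˡ X s) α) ψ (trans centre≡v (sym ψ₀≡v)))

right-star-join-colourable : ∀ b H {h} → size H ≡ suc h → RedFreeColourable H →
  RedFreeColourable (Join (Star 1 (suc b)) H)
right-star-join-colourable b H |H|≡1+h H-colourable =
  join-colourable (Star 1 (suc b)) H refl |H|≡1+h starts-colourable H-colourable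
  where
  starts-colourable : StartsColourable (Star 1 (suc b)) H b
  starts-colourable c X N bounded no-copy s s-decides =
    greedy-right c (X ∩ s) N b (λ v → bounded v ∘ ∩-⊆ˡ X s v) λ v v∈ →
      few-red-right-neighbours c (X ∩ s) N b v v∈ λ α _ →
        let last∈ = embed-in α b ≤-refl
            ψ , ψ₀≡last = proj₁ (s-decides (embed α b) (bounded _ (∩-⊆ˡ X s _ last∈))) (∩-⊆ʳ X s _ last∈)
        in no-copy (join-copy (Star 1 (suc b)) H refl (copy-⊆ (∩-⊆ˡ X s) α) ψ (sym ψ₀≡last))

-- Lower bound

CutConnected : OrdGraph → Set
CutConnected G = ∀ k → 1 ≤ k → k < size G →
  Σ ℕ λ i → Σ ℕ λ j → i < k × k ≤ j × j < size G × adj G i j ≡ true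

left-star-cut-connected : ∀ a → CutConnected (Star (suc a) 1)
left-star-cut-connected a (suc k) _ 1+k<|S| = k , a , ≤-refl , 1+k≤a , a<|S| , edge
  where
  1+k≤a = ≤-pred (subst (suc k <_) (size-left-star a) 1+k<|S|)
  a<|S| = subst (a <_) (sym (size-left-star a)) ≤-refl
  edge : adj (Star (suc a) 1) k a ≡ true
  edge rewrite ≢⇒≡ᵇ≡false (<⇒≢ 1+k≤a) | ≡⇒≡ᵇ≡true (refl {x = a}) = refl

right-star-cut-connected : ∀ b → CutConnected (Star 1 (suc b))
right-star-cut-connected b (suc k) _ k<|S| = 0 , suc k , s≤s z≤n , ≤-refl , k<|S| , refl

join-cut-connected : ∀ G H {g h} → size G ≡ suc g → size H ≡ suc h →
  CutConnected G → CutConnected H → CutConnected (Join G H)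
join-cut-connected G H {g} {h} |G|≡1+g |H|≡1+h G-conn H-conn k 1≤k k<|J| with k <? size G
... | yes k<|G| =
  let i , j , i<k , k≤j , j<|G| , e = G-conn k 1≤k k<|G|
  in i , j , i<k , k≤j , <-≤-trans j<|G| |G|≤|J| ,
     adj-Join-introˡ G H |G|≡1+g i j (<-≤-trans i<k k≤j) j<|G| e
  where
  |G|≤|J| : size G ≤ size (Join G H)
  |G|≤|J| = subst₂ _≤_ (sym |G|≡1+g) (sym (size-Join-suc G H |G|≡1+g |H|≡1+h)) (s≤s (m≤m+n g h))
... | no k≮|G| =
  let i , j , i<k∸g , k∸g≤j , j<|H| , e =
        H-conn (k ∸ g) (m<n⇒0<n∸m g<k) (index-in-H G H |G|≡1+g (<⇒≤ g<k) k<|J|)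
  in i + g , j + g , shift-< i<k∸g , shift-≤ k∸g≤j ,
     subst₂ _<_ (+-comm g j) (sym (size-Join G H |G|≡1+g)) (+-monoʳ-< g j<|H|) ,
     adj-Join-introʳ G H |G|≡1+g (i + g) (j + g) (m≤n+m g i) (<-≤-trans (shift-< i<k∸g) (shift-≤ k∸g≤j))
       (subst₂ (λ x y → adj H x y ≡ true) (sym (m+n∸n≡m i g)) (sym (m+n∸n≡m j g)) e)
  where
  g<k : g < k
  g<k = subst (_≤ k) |G|≡1+g (≮⇒≥ k≮|G|)
  shift-< : ∀ {i} → i < k ∸ g → i + g < k
  shift-< {i} i< = subst (i + g <_) (m∸n+n≡m (<⇒≤ g<k)) (+-monoˡ-< g i<)
  shift-≤ : ∀ {j} → k ∸ g ≤ j → k ≤ j + g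
  shift-≤ {j} ≤j = subst (_≤ j + g) (m∸n+n≡m (<⇒≤ g<k)) (+-monoˡ-≤ g ≤j)

[m+n]/n≡1+m/n : ∀ m n .{{_ : NonZero n}} → (m + n) / n ≡ suc (m / n)
[m+n]/n≡1+m/n m n = trans (m/n≡1+[m∸n]/n (m≤n+m n m)) (cong (λ x → suc (x / n)) (m+n∸n≡m m n))

block-colouring : ∀ D .{{_ : NonZero D}} → Colouring
block-colouring D i j = (i / D) ≡ᵇ (j / D)

module _ (D : ℕ) .{{_ : NonZero D}} where

  red-copy-in-one-block : ∀ {N} G → CutConnected G → (copy : MonoCopy N (block-colouring D) true G) →
    ∀ j → j < size G → proj₁ copy j / D ≡ proj₁ copy 0 / D
  red-copy-in-one-block G conn _                           zero    _       = refl
  red-copy-in-one-block G conn copy@(φ , _ , inc , red) (suc j) 1+j<|G| =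
    trans (≤-antisym step-down step-up) (red-copy-in-one-block G conn copy j j<|G|)
    where
    j<|G| = <-trans (n<1+n j) 1+j<|G|
    cut = conn (suc j) (s≤s z≤n) 1+j<|G|
    step-up : φ j / D ≤ φ (suc j) / D
    step-up = /-monoˡ-≤ D (<⇒≤ (inc j (suc j) (n<1+n j) 1+j<|G|))
    step-down : φ (suc j) / D ≤ φ j / D
    step-down =
      let i , k , i<1+j , 1+j≤k , k<|G| , e = cut in begin
      φ (suc j) / D  ≤⟨ /-monoˡ-≤ D (Increasing⇒≤ inc 1+j≤k k<|G|) ⟩
      φ k / D        ≡⟨ ≡ᵇ≡true⇒≡ (red i k (<-≤-trans i<1+j 1+j≤k) k<|G| e) ⟨
      φ i / D        ≤⟨ /-monoˡ-≤ D (Increasing⇒≤ inc (≤-pred i<1+j) j<|G|) ⟩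
      φ j / D        ∎
      where open ≤-Reasoning

  no-red-copy : ∀ {N} G → size G ≡ suc D → CutConnected G → ¬ MonoCopy N (block-colouring D) true G
  no-red-copy G |G|≡1+D conn copy@(φ , _ , inc , _) =
    <-irrefl (sym (red-copy-in-one-block G conn copy D D<|G|)) (begin-strict
      φ 0 / D        <⟨ n<1+n _ ⟩
      suc (φ 0 / D)  ≡⟨ [m+n]/n≡1+m/n (φ 0) D ⟨
      (φ 0 + D) / D  ≤⟨ /-monoˡ-≤ D (Increasing⇒+ inc D D<|G|) ⟩
      φ D / D        ∎)
    where
    open ≤-Reasoning
    D<|G| = subst (D <_) (sym |G|≡1+D) ≤-refl

  no-blue-clique : ∀ {N} n → N ≤ D * n → ¬ MonoCopy N (block-colouring D) false (K (suc n))
  no-blue-clique {N} n N≤Dn (φ , φ<N , inc , blue) =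
    <⇒≱ (m<n*o⇒m/o<n (<-≤-trans (φ<N n ≤-refl) (subst (N ≤_) (*-comm D n) N≤Dn))) (j≤block n ≤-refl)
    where
    j≤block : ∀ j → j < suc n → j ≤ φ j / D
    j≤block zero    _       = z≤n
    j≤block (suc j) 1+j<1+n = ≤-<-trans (j≤block j (<-trans (n<1+n j) 1+j<1+n)) (≤∧≢⇒<
      (/-monoˡ-≤ D (<⇒≤ (inc j (suc j) (n<1+n j) 1+j<1+n)))
      (λ same → not-¬ (≡⇒≡ᵇ≡true same) (blue j (suc j) (n<1+n j) 1+j<1+n refl)))

lower-bound : ∀ G {g} → size G ≡ suc g → CutConnected G → ∀ n N → N ≤ g * n → ¬ Arrows N G (K (suc n))
lower-bound G {zero} |G|≡1 _ n zero _ arrows with arrows (λ _ _ → true)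
... | inj₁ (φ , φ<0 , _) = n≮0 (φ<0 0 (subst (0 <_) (sym |G|≡1) ≤-refl))
... | inj₂ (φ , φ<0 , _) = n≮0 (φ<0 0 (s≤s z≤n))
lower-bound G {suc d} |G|≡2+d conn n N N≤g*n arrows with arrows (block-colouring (suc d))
... | inj₁ red  = no-red-copy (suc d) G |G|≡2+d conn red
... | inj₂ blue = no-blue-clique (suc d) n N≤g*n blue

-- Upper bound

∀<? : ∀ {P : ℕ → Set} → (∀ i → Dec (P i)) → ∀ m → Dec (∀ i → i < m → P i)
∀<? P? m = map′ (λ all i → all {i}) (λ all {i} → all i) (allUpTo? P? m)

∀<<? : ∀ {R : ℕ → ℕ → Set} → (∀ i j → Dec (R i j)) → ∀ m → Dec (∀ i j → i < j → j < m → R i j)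
∀<<? R? m = map′ (λ all i j i<j j<m → all j j<m i i<j) (λ all j j<m i i<j → all i j i<j j<m)
                 (∀<? (λ j → ∀<? (λ i → R? i j) j) m)

module _ {N m : ℕ} {Q : (ℕ → ℕ) → Set} (Q? : ∀ φ → Dec (Q φ))
         (Q-local : ∀ {φ ψ} → (∀ i → i < m → φ i ≡ ψ i) → Q φ → Q ψ)
         (Q-bounded : ∀ {φ} → Q φ → ∀ i → i < m → φ i < N) where

  private
    Extends : ℕ → (ℕ → ℕ) → Set
    Extends k ψ = Σ (ℕ → ℕ) λ φ → Q φ × (∀ i → i < k → φ i ≡ ψ i)

    extends? : ∀ t k ψ → t + k ≡ m → Dec (Extends k ψ)
    extends? zero k ψ k≡m with Q? ψ
    ... | yes Qψ = yes (ψ , Qψ , λ _ _ → refl)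
    ... | no ¬Qψ = no λ (φ , Qφ , agree) →
      ¬Qψ (Q-local (λ i i<m → agree i (subst (i <_) (sym k≡m) i<m)) Qφ)
    extends? (suc t) k ψ 1+t+k≡m with anyUpTo? (λ w → extends? t (suc k) (ψ [ k ↦ w ]) t+1+k≡m) N
      where t+1+k≡m = trans (+-suc t k) 1+t+k≡m
    ... | yes (w , _ , φ , Qφ , agree) =
      yes (φ , Qφ , λ i i<k → trans (agree i (m<n⇒m<1+n i<k)) ([↦]-other ψ w (<⇒≢ i<k)))
    ... | no none = no λ (φ , Qφ , agree) →
      none (φ k , Q-bounded Qφ k (subst (k <_) 1+t+k≡m (s≤s (m≤n+m k t))) , φ , Qφ , agree′ φ agree)
      where
      agree′ : ∀ φ → (∀ i → i < k → φ i ≡ ψ i) → ∀ i → i < suc k → φ i ≡ (ψ [ k ↦ φ k ]) i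
      agree′ φ agree i i<1+k with m<1+n⇒m<n∨m≡n i<1+k
      ... | inj₁ i<k  = trans (agree i i<k) (sym ([↦]-other ψ (φ k) (<⇒≢ i<k)))
      ... | inj₂ refl = sym ([↦]-same ψ i (φ i))

  bounded-search : Dec (Σ (ℕ → ℕ) Q)
  bounded-search = map′ (λ (φ , Qφ , _) → φ , Qφ) (λ (φ , Qφ) → φ , Qφ , λ _ ())
                        (extends? m 0 (λ _ → 0) (+-identityʳ m))

MonoCopy? : ∀ N c b G → Dec (MonoCopy N c b G)
MonoCopy? N c b G = bounded-search Q? Q-local proj₁
  where
  Q : (ℕ → ℕ) → Set
  Q φ = (∀ i → i < size G → φ i < N) × Increasing φ (size G) ×
        (∀ i j → i < j → j < size G → adj G i j ≡ true → c (φ i) (φ j) ≡ b)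
  Q? : ∀ φ → Dec (Q φ)
  Q? φ = ∀<? (λ i → φ i <? N) (size G)
     ×-dec ∀<<? (λ i j → φ i <? φ j) (size G)
     ×-dec ∀<<? (λ i j → (adj G i j ≟ᵇ true) →-dec (c (φ i) (φ j) ≟ᵇ b)) (size G)
  Q-local : ∀ {φ ψ} → (∀ i → i < size G → φ i ≡ ψ i) → Q φ → Q ψ
  Q-local {φ} {ψ} φ≗ψ (φ<N , φ-inc , φ-col) =
    (λ i i<|G| → subst (_< N) (φ≗ψ i i<|G|) (φ<N i i<|G|)) ,
    (λ i j i<j j<|G| → subst₂ _<_ (φ≗ψ i (<-trans i<j j<|G|)) (φ≗ψ j j<|G|) (φ-inc i j i<j j<|G|)) ,
    (λ i j i<j j<|G| e → subst₂ (λ x y → c x y ≡ b) (φ≗ψ i (<-trans i<j j<|G|)) (φ≗ψ j j<|G|)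
                                 (φ-col i j i<j j<|G| e))

colour-class⇒blue-clique : ∀ {c X D} (κ : ProperColouring c ⟨ X ⟩ D) j t N →
  t ≤ count (X ∩ colour κ ⁻¹[ j ]) N → MonoCopy N c false (K t)
colour-class⇒blue-clique {c} {X} κ j t N t≤count = φ , (λ i → proj₁ ∘ member i) , inc , blue
  where
  class = colour κ ⁻¹[ j ]
  clique = enumerate (X ∩ class) N t t≤count
  φ = proj₁ clique
  member = proj₁ (proj₂ clique)
  inc = proj₂ (proj₂ clique)
  coloured-j : ∀ i → i < t → colour κ (φ i) ≡ j
  coloured-j i i<t = ≡ᵇ≡true⇒≡ (∩-⊆ʳ X class (φ i) (proj₂ (member i i<t)))
  blue : ∀ i k → i < k → k < t → true ≡ true → c (φ i) (φ k) ≡ false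
  blue i k i<k k<t _ = ¬-not λ red →
    proper κ (φ i) (φ k) (inc i k i<k k<t)
      (∩-⊆ˡ X class (φ i) (proj₂ (member i (<-trans i<k k<t))))
      (∩-⊆ˡ X class (φ k) (proj₂ (member k k<t))) red
      (trans (coloured-j i (<-trans i<k k<t)) (sym (coloured-j k k<t)))

upper-bound : ∀ G → RedFreeColourable G → ∀ n → Arrows ((size G ∸ 1) * n + 1) G (K (suc n))
upper-bound G G-colourable n c
  with MonoCopy? ((size G ∸ 1) * n + 1) c true G | MonoCopy? ((size G ∸ 1) * n + 1) c false (K (suc n))
... | yes red    | _         = inj₁ red
... | no  _      | yes blue  = inj₂ blue
... | no  no-red | no no-blue = ⊥-elim (G-colourable c X N (λ _ → <ᵇ≡true⇒<) no-red-in-X no-colouring)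
  where
  D = size G ∸ 1
  N = D * n + 1
  X : ℕ → Bool
  X v = v <ᵇ N
  no-red-in-X : ¬ RedCopy c X G
  no-red-in-X (redCopy φ φ-in inc red) = no-red (φ , (λ i → <ᵇ≡true⇒< ∘ φ-in i) , inc , red)
  Dn<|X| : D * n < count X N
  Dn<|X| = subst (D * n <_) (sym (count-all X N (λ _ → <⇒<ᵇ≡true))) (m<m+n (D * n) (s≤s z≤n))
  no-colouring : ¬ ProperColouring c ⟨ X ⟩ D
  no-colouring κ =
    let j , _ , n<|class| = pigeonhole D X (colour κ) n N (λ v _ → colour<D κ v) Dn<|X|
    in no-blue (colour-class⇒blue-clique κ j (suc n) N n<|class|)

record Admissible (G : OrdGraph) : Set where
  field
    last                : ℕ
    size≡1+last         : size G ≡ suc last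
    cut-connected       : CutConnected G
    red-free-colourable : RedFreeColourable G
open Admissible

admissible⇒good : ∀ {G} → Admissible G → Good G
admissible⇒good {G} adm (suc n) _ =
  upper-bound G (red-free-colourable adm) n ,
  λ N N<bound → lower-bound G (size≡1+last adm) (cut-connected adm) n N
    (subst (λ m → N ≤ (m ∸ 1) * n) (size≡1+last adm) (≤-pred (subst (N <_) (+-comm _ 1) N<bound)))

star-admissible : ∀ {l r} → OneSidedParams (l , r) → Admissible (Star l r)
star-admissible {suc a} {suc b} (_ , _ , inj₁ refl) =
  record { last = b ; size≡1+last = refl
         ; cut-connected = right-star-cut-connected b ; red-free-colourable = right-star-colourable b }
star-admissible {suc a} {suc b} (_ , _ , inj₂ refl) =
  record { last = a ; size≡1+last = size-left-star a
         ; cut-connected = left-star-cut-connected a ; red-free-colourable = left-star-colourable a }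

star-join-colourable : ∀ {l r H h} → OneSidedParams (l , r) → size H ≡ suc h →
  RedFreeColourable H → RedFreeColourable (Join (Star l r) H)
star-join-colourable {suc a} {suc b} {H} (_ , _ , inj₁ refl) = right-star-join-colourable b H
star-join-colourable {suc a} {suc b} {H} (_ , _ , inj₂ refl) = left-star-join-colourable a H

star-join-admissible : ∀ {l r H} → OneSidedParams (l , r) → Admissible H → Admissible (Join (Star l r) H)
star-join-admissible {l} {r} {H} params H-adm = record
  { last = last S-adm + last H-adm
  ; size≡1+last = size-Join-suc (Star l r) H (size≡1+last S-adm) (size≡1+last H-adm)
  ; cut-connected = join-cut-connected (Star l r) H (size≡1+last S-adm) (size≡1+last H-adm)
                      (cut-connected S-adm) (cut-connected H-adm)
  ; red-free-colourable = star-join-colourable params (size≡1+last H-adm) (red-free-colourable H-adm)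
  }
  where S-adm = star-admissible params

caterpillar-admissible : ∀ p qs → All OneSidedParams (p ∷ qs) → Admissible (Caterpillar (p ∷ qs))
caterpillar-admissible p       []       (params ∷ [])  = star-admissible params
caterpillar-admissible (l , r) (q ∷ qs) (params ∷ all) =
  star-join-admissible params (caterpillar-admissible q qs all)

corollary13 : (ps : List⁺ (ℕ × ℕ)) → All OneSidedParams (toList ps) → Good (Caterpillar ps)
corollary13 (p ∷ qs) all = admissible⇒good (caterpillar-admissible p qs all)
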